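{- Let $\mathtt{QTh}$ be the quantitative equational theory over the signature $\{\oplus\}\cup\{+_p\}_{p\in(0,1)}\cup\{\star\}$ generated by the axioms of quantitative pointed convex semilattices together with the bottom axiom $\emptyset\vdash x\oplus\star=_0x$ and the black-hole axioms $\emptyset\vdash x+_p\star=_0\star$ for all $p\in(0,1)$. Then $\mathtt{QTh}$ is trivial: $\emptyset\vdash x=_0y$ belongs to $\mathtt{QTh}$ (for distinct variables $x,y$).
   Context: A quantitative inference is $\{x_i=_{\epsilon_i}y_i\}_{i\in I}\vdash s=_\epsilon t$ with $\epsilon,\epsilon_i\in[0,1]$. Quantitative equational theories are closed under the deductive system of quantitative equational logic over 1-bounded metric spaces (Bacci–Mardare–Panangaden–Plotkin), which includes: reflexivity $\vdash x=_0x$, symmetry, triangle inequality (from $x=_\epsilon y$, $y=_{\epsilon'}z$ infer $x=_{\epsilon+\epsilon'}z$), (Max) from $x=_\epsilon y$ infer $x=_{\epsilon'}y$ for $\epsilon'\ge\epsilon$, (Arch) $\{x=_{\epsilon}y\}_{\epsilon>0}\vdash x=_0y$, 1-boundedness $\vdash x=_1y$, substitution, cut and assumption. The axioms of quantitative pointed convex semilattices are: $\emptyset\vdash s=_0t$ for each of $x\oplus(y\oplus z)=(x\oplus y)\oplus z$, $x\oplus y=y\oplus x$, $x\oplus x=x$, $(x+_qy)+_pz=x+_{pq}(y+_{\frac{p(1-q)}{1-pq}}z)$, $x+_py=y+_{1-p}x$, $x+_px=x$, $x+_p(y\oplus z)=(x+_py)\oplus(x+_pz)$; (H) $\{x_1=_{\epsilon_1}y_1,x_2=_{\epsilon_2}y_2\}\vdash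 x_1\oplus x_2=_{\max(\epsilon_1,\epsilon_2)}y_1\oplus y_2$; (K) $\{x_1=_{\epsilon_1}y_1,x_2=_{\epsilon_2}y_2\}\vdash x_1+_px_2=_{p\epsilon_1+(1-p)\epsilon_2}y_1+_py_2$. -}

module Defs where

open import Level using (0ℓ)
open import Data.Nat using (ℕ)
open import Data.Product using (Σ; _×_; ∃; _,_; proj₁)
open import Data.Sum using (_⊎_; inj₁; inj₂)
open import Data.Empty using (⊥)
open import Relation.Binary.PropositionalEquality using (_≡_; _≢_; refl)
open import Relation.Binary.Structures using (IsStrictTotalOrder)
open import Algebra.Structures using (IsCommutativeRing)

-- The real numbers, axiomatised as a Dedekind-complete ordered field
-- (this characterises ℝ up to isomorphism).  The theorem is stated for
-- every such structure.

record RealField : Set₁ where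
  infixl 6 _+_ _-_
  infixl 7 _*_
  infix 4 _<_ _≤_
  field
    ℝ       : Set
    0ℝ 1ℝ   : ℝ
    _+_ _*_ : ℝ → ℝ → ℝ
    -_      : ℝ → ℝ
    _⁻¹     : ℝ → ℝ          -- total; only meaningful away from 0
    _<_     : ℝ → ℝ → Set
    isCommutativeRing : IsCommutativeRing _≡_ _+_ _*_ -_ 0ℝ 1ℝ
    inverse : ∀ x → x ≢ 0ℝ → x * (x ⁻¹) ≡ 1ℝ
    isStrictTotalOrder : IsStrictTotalOrder _≡_ _<_
    0<1     : 0ℝ < 1ℝ
    +-mono-< : ∀ {x y} z → x < y → x + z < y + z
    *-pos    : ∀ {x y} → 0ℝ < x → 0ℝ < y → 0ℝ < x * y

  _≤_ : ℝ → ℝ → Set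
  x ≤ y = x < y ⊎ x ≡ y

  _-_ : ℝ → ℝ → ℝ
  x - y = x + (- y)

  field
    complete : (P : ℝ → Set) → ∃ P → (∃ λ b → ∀ x → P x → x ≤ b) →
               ∃ λ s → (∀ x → P x → x ≤ s) × (∀ b → (∀ x → P x → x ≤ b) → s ≤ b)

module QuantitativeLogic (R : RealField) where
  open RealField R

  Prob : Set
  Prob = Σ ℝ (λ p → (0ℝ < p) × (p < 1ℝ))

  I : Set
  I = Σ ℝ (λ e → (0ℝ ≤ e) × (e ≤ 1ℝ))

  val : ∀ {A : ℝ → Set} → Σ ℝ A → ℝ
  val = proj₁

  𝟘 : I
  𝟘 = 0ℝ , inj₂ refl , inj₁ 0<1

  𝟙 : I
  𝟙 = 1ℝ , inj₁ 0<1 , inj₂ refl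

  infixl 5 _⊕_
  infixl 6 _+[_]_
  data Term : Set where
    var    : ℕ → Term
    _⊕_    : Term → Term → Term
    _+[_]_ : Term → Prob → Term → Term
    ⋆      : Term

  Subst : Set
  Subst = ℕ → Term

  _[_] : Term → Subst → Term
  var n [ σ ] = σ n
  (s ⊕ t) [ σ ] = (s [ σ ]) ⊕ (t [ σ ])
  (s +[ p ] t) [ σ ] = (s [ σ ]) +[ p ] (t [ σ ])
  ⋆ [ σ ] = ⋆

  infix 4 _≡[_]_
  data QEq : Set where
    _≡[_]_ : Term → I → Term → QEq

  substQ : QEq → Subst → QEq
  substQ (s ≡[ e ] t) σ = (s [ σ ]) ≡[ e ] (t [ σ ])

  Ctx : Set₁
  Ctx = QEq → Set

  ∅ : Ctx
  ∅ _ = ⊥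

  substCtx : Ctx → Subst → Ctx
  substCtx Γ σ ψ = ∃ λ χ → Γ χ × (ψ ≡ substQ χ σ)

  -- Γ ⊢ φ : the inference Γ ⊢ φ belongs to QTh, the least quantitative
  -- equational theory containing the axioms of quantitative pointed convex
  -- semilattices, the bottom axiom and the black-hole axioms.
  infix 2 _⊢_
  data _⊢_ (Γ : Ctx) : QEq → Set₁ where
    assum  : ∀ {φ} → Γ φ → Γ ⊢ φ
    refl₀  : ∀ t → Γ ⊢ t ≡[ 𝟘 ] t
    sym    : ∀ {s t e} → Γ ⊢ s ≡[ e ] t → Γ ⊢ t ≡[ e ] s
    triang : ∀ {s t u e e′ e″} → Γ ⊢ s ≡[ e ] t → Γ ⊢ t ≡[ e′ ] u →
             val e″ ≡ val e + val e′ → Γ ⊢ s ≡[ e″ ] u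
    max    : ∀ {s t e e′} → Γ ⊢ s ≡[ e ] t → val e ≤ val e′ → Γ ⊢ s ≡[ e′ ] t
    arch   : ∀ {s t} → (∀ (e : I) → 0ℝ < val e → Γ ⊢ s ≡[ e ] t) →
             Γ ⊢ s ≡[ 𝟘 ] t
    bound  : ∀ s t → Γ ⊢ s ≡[ 𝟙 ] t
    subst  : ∀ {Δ φ} (σ : Subst) → Δ ⊢ φ → Γ ≡ substCtx Δ σ → Γ ⊢ substQ φ σ
    cut    : ∀ {Δ φ} → (∀ ψ → Δ ψ → Γ ⊢ ψ) → Δ ⊢ φ → Γ ⊢ φ
    ⊕-assoc : ∀ x y z → Γ ⊢ x ⊕ (y ⊕ z) ≡[ 𝟘 ] (x ⊕ y) ⊕ z
    ⊕-comm  : ∀ x y → Γ ⊢ x ⊕ y ≡[ 𝟘 ] y ⊕ x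
    ⊕-idem  : ∀ x → Γ ⊢ x ⊕ x ≡[ 𝟘 ] x
    +-assoc : ∀ x y z (p q pq r : Prob) → val pq ≡ val p * val q →
              val r ≡ (val p * (1ℝ - val q)) * ((1ℝ - val p * val q) ⁻¹) →
              Γ ⊢ (x +[ q ] y) +[ p ] z ≡[ 𝟘 ] x +[ pq ] (y +[ r ] z)
    +-comm  : ∀ x y (p p′ : Prob) → val p′ ≡ 1ℝ - val p →
              Γ ⊢ x +[ p ] y ≡[ 𝟘 ] y +[ p′ ] x
    +-idem  : ∀ x (p : Prob) → Γ ⊢ x +[ p ] x ≡[ 𝟘 ] x
    distrib : ∀ x y z (p : Prob) →
              Γ ⊢ x +[ p ] (y ⊕ z) ≡[ 𝟘 ] (x +[ p ] y) ⊕ (x +[ p ] z)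
    H : ∀ {x₁ y₁ x₂ y₂ e₁ e₂ e} →
        Γ ⊢ x₁ ≡[ e₁ ] y₁ → Γ ⊢ x₂ ≡[ e₂ ] y₂ →
        val e₁ ≤ val e → val e₂ ≤ val e → (val e ≡ val e₁ ⊎ val e ≡ val e₂) →
        Γ ⊢ x₁ ⊕ x₂ ≡[ e ] y₁ ⊕ y₂
    K : ∀ {x₁ y₁ x₂ y₂ e₁ e₂ e} (p : Prob) →
        Γ ⊢ x₁ ≡[ e₁ ] y₁ → Γ ⊢ x₂ ≡[ e₂ ] y₂ →
        val e ≡ val p * val e₁ + (1ℝ - val p) * val e₂ →
        Γ ⊢ x₁ +[ p ] x₂ ≡[ e ] y₁ +[ p ] y₂
    bottom   : ∀ x → Γ ⊢ x ⊕ ⋆ ≡[ 𝟘 ] x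
    blackhole : ∀ x (p : Prob) → Γ ⊢ x +[ p ] ⋆ ≡[ 𝟘 ] ⋆

-- For p ∈ (0,1), the metric axiom K applied to x =₀ x and x =₁ ⋆ gives
-- x = x +_p x  =_{1-p}  x +_p ⋆ = ⋆ by idempotence and the black-hole axiom.
-- Hence every term is within every positive distance of ⋆, so (Arch) makes
-- it equal to ⋆, and any two terms are then equal.
module Submission where

open import Defs
open import Level using (0ℓ)
open import Data.Product using (_,_)
open import Data.Sum using (inj₁; inj₂)
open import Relation.Binary.PropositionalEquality as ≡ using (_≡_; cong)
open import Algebra.Bundles using (AbelianGroup)
open import Algebra.Structures using (IsCommutativeRing)
import Algebra.Properties.AbelianGroup as AbelianGroupProperties

module Collapse (R : RealField) where
  open RealField R
  open QuantitativeLogic R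
  open IsCommutativeRing isCommutativeRing
    using (+-identityˡ; +-identityʳ; zeroʳ; *-identityʳ; -‿inverseʳ; +-isAbelianGroup)
    renaming (+-assoc to +-assocℝ; +-comm to +-commℝ)
  open ≡.≡-Reasoning

  +-abelianGroup : AbelianGroup 0ℓ 0ℓ
  +-abelianGroup = record { isAbelianGroup = +-isAbelianGroup }

  open AbelianGroupProperties +-abelianGroup
    using (⁻¹-anti-homo‿-; xyx⁻¹≈y; //-rightDividesˡ)

  1-[1-e]≡e : ∀ e → 1ℝ - (1ℝ - e) ≡ e
  1-[1-e]≡e e = begin
    1ℝ + - (1ℝ - e)   ≡⟨ cong (1ℝ +_) (⁻¹-anti-homo‿- 1ℝ e) ⟩
    1ℝ + (e - 1ℝ)     ≡⟨ +-assocℝ 1ℝ e (- 1ℝ) ⟨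
    1ℝ + e - 1ℝ       ≡⟨ xyx⁻¹≈y 1ℝ e ⟩
    e                 ∎

  1-e>0 : ∀ {e} → e < 1ℝ → 0ℝ < 1ℝ - e
  1-e>0 {e} e<1 = ≡.subst (_< 1ℝ - e) (-‿inverseʳ e) (+-mono-< (- e) e<1)

  1-e<1 : ∀ {e} → 0ℝ < e → 1ℝ - e < 1ℝ
  1-e<1 {e} e>0 = ≡.subst₂ _<_ (+-identityˡ (1ℝ - e)) e+[1-e]≡1 (+-mono-< (1ℝ - e) e>0)
    where
    e+[1-e]≡1 : e + (1ℝ - e) ≡ 1ℝ
    e+[1-e]≡1 = ≡.trans (+-commℝ e (1ℝ - e)) (//-rightDividesˡ e 1ℝ)

  complement : ∀ {e} → 0ℝ < e → e < 1ℝ → Prob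
  complement {e} e>0 e<1 = 1ℝ - e , 1-e>0 e<1 , 1-e<1 e>0

  ≡⋆-within-1-p : ∀ {Γ} x (p : Prob) {e : I} → val e ≡ 1ℝ - val p → Γ ⊢ x ≡[ e ] ⋆
  ≡⋆-within-1-p x p {e} e≡1-p =
    triang {e = e} {e′ = 𝟘}
      (triang {e = 𝟘} {e′ = e} (sym (+-idem x p)) (K p (refl₀ x) (bound x ⋆) kernel) (≡.sym (+-identityˡ _)))
      (blackhole x p)
      (≡.sym (+-identityʳ _))
    where
    kernel : val e ≡ val p * 0ℝ + (1ℝ - val p) * 1ℝ
    kernel = begin
      val e                              ≡⟨ e≡1-p ⟩
      1ℝ - val p                         ≡⟨ +-identityˡ _ ⟨
      0ℝ + (1ℝ - val p)                  ≡⟨ ≡.cong₂ _+_ (zeroʳ (val p)) (*-identityʳ _) ⟨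
      val p * 0ℝ + (1ℝ - val p) * 1ℝ     ∎

  ≡⋆-within-positive : ∀ {Γ} x (e : I) → 0ℝ < val e → Γ ⊢ x ≡[ e ] ⋆
  ≡⋆-within-positive x (e , _ , inj₁ e<1) e>0 =
    ≡⋆-within-1-p x (complement e>0 e<1) (≡.sym (1-[1-e]≡e e))
  ≡⋆-within-positive x (e , _ , inj₂ e≡1) _ = max (bound x ⋆) (inj₂ (≡.sym e≡1))

  ≡⋆ : ∀ {Γ} x → Γ ⊢ x ≡[ 𝟘 ] ⋆
  ≡⋆ x = arch (≡⋆-within-positive x)

  ≡-any : ∀ {Γ} s t → Γ ⊢ s ≡[ 𝟘 ] t
  ≡-any s t = triang (≡⋆ s) (sym (≡⋆ t)) (≡.sym (+-identityˡ 0ℝ))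

mainTheorem3 : (R : RealField) →
    let open QuantitativeLogic R in
    ∅ ⊢ var 0 ≡[ 𝟘 ] var 1
mainTheorem3 R = ≡-any (var 0) (var 1)
  where open QuantitativeLogic R; open Collapse R
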